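{- Let $s$ be a Bosbach state on a bounded pseudo-BCK algebra $A$. The following are equivalent: (a) $s$ is a state-morphism; (b) $\mathrm{Ker}(s)$ is a normal and maximal filter of $A$.
   Context: A pseudo-BCK algebra is a structure $(A,\le,\rightarrow,\rightsquigarrow,1)$ with $\le$ a binary relation, $\rightarrow,\rightsquigarrow$ binary operations and $1\in A$, such that for all $x,y,z\in A$: $x\rightarrow y\le (y\rightarrow z)\rightsquigarrow(x\rightarrow z)$ and $x\rightsquigarrow y\le (y\rightsquigarrow z)\rightarrow(x\rightsquigarrow z)$; $x\le (x\rightarrow y)\rightsquigarrow y$ and $x\le (x\rightsquigarrow y)\rightarrow y$; $x\le x$; $x\le 1$; antisymmetry of $\le$; $x\le y$ iff $x\rightarrow y=1$ iff $x\rightsquigarrow y=1$. Bounded: has a least element $0$. A filter is a set $F\ni1$ with $a,a\rightarrow b\in F\Rightarrow b\in F$; normal if $a\rightarrow b\in F\iff a\rightsquigarrow b\in F$; maximal if proper and not properly contained in another proper filter. A Bosbach state is a map $s:A\to[0,1]$ with $s(x)+s(x\rightarrow y)=s(y)+s(y\rightarrow x)$, $s(x)+s(x\rightsquigarrow y)=s(y)+s(y\rightsquigarrow x)$, $s(0)=0$, $s(1)=1$; $\mathrm{Ker}(s)=\{a:s(a)=1\}$. A state-morphism is a map $m:A\to[0,1]$ with $m(0)=0$ and $m(x\rightarrow y)=m(x\rightsquigarrow y)=\min\{1-m(x)+m(y),1\}$. -}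

module Defs where

open import Level using (0ℓ)
open import Data.Product using (Σ; ∃; _×_; _,_)
open import Relation.Nullary using (¬_; yes; no)
open import Relation.Binary using (Decidable)
open import Relation.Binary.Structures using (IsDecTotalOrder)
open import Relation.Binary.PropositionalEquality using (_≡_)
open import Algebra.Structures using (IsCommutativeRing)

-- The real numbers, axiomatised as a (Dedekind-)complete ordered field.
-- Any two models are isomorphic, so quantifying over all models is the
-- same as speaking about ℝ.

record RealField : Set₁ where
  infixl 6 _+_ _-_
  infixl 7 _*_
  infix 4 _≤_
  field
    ℝ      : Set
    _+_    : ℝ → ℝ → ℝ
    _*_    : ℝ → ℝ → ℝ
    -_     : ℝ → ℝ
    0ℝ     : ℝ
    1ℝ     : ℝ
    _≤_    : ℝ → ℝ → Set
    isCommutativeRing : IsCommutativeRing _≡_ _+_ _*_ -_ 0ℝ 1ℝ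
    0≢1    : ¬ (0ℝ ≡ 1ℝ)
    inverse : ∀ x → ¬ (x ≡ 0ℝ) → ∃ λ y → x * y ≡ 1ℝ
    isDecTotalOrder : IsDecTotalOrder _≡_ _≤_
    +-mono-≤ : ∀ {x y} z → x ≤ y → x + z ≤ y + z
    *-nonneg : ∀ {x y} → 0ℝ ≤ x → 0ℝ ≤ y → 0ℝ ≤ x * y
    complete : (P : ℝ → Set) → (∃ λ x → P x) →
               (∃ λ b → ∀ x → P x → x ≤ b) →
               ∃ λ σ → (∀ x → P x → x ≤ σ) ×
                       (∀ b → (∀ x → P x → x ≤ b) → σ ≤ b)

  _-_ : ℝ → ℝ → ℝ
  x - y = x + (- y)

  _≤?_ : Decidable _≤_
  _≤?_ = IsDecTotalOrder._≤?_ isDecTotalOrder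

  min : ℝ → ℝ → ℝ
  min x y with x ≤? y
  ... | yes _ = x
  ... | no  _ = y

record BoundedPseudoBCK : Set₁ where
  infix 4 _≤_
  infixr 5 _⇒_ _⇝_
  field
    Carrier : Set
    _≤_     : Carrier → Carrier → Set
    _⇒_     : Carrier → Carrier → Carrier
    _⇝_     : Carrier → Carrier → Carrier
    one     : Carrier
    zero    : Carrier
    ax1     : ∀ x y z → (x ⇒ y) ≤ ((y ⇒ z) ⇝ (x ⇒ z))
    ax1'    : ∀ x y z → (x ⇝ y) ≤ ((y ⇝ z) ⇒ (x ⇝ z))
    ax2     : ∀ x y → x ≤ ((x ⇒ y) ⇝ y)
    ax2'    : ∀ x y → x ≤ ((x ⇝ y) ⇒ y)
    refl≤   : ∀ x → x ≤ x
    ≤one    : ∀ x → x ≤ one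
    antisym : ∀ {x y} → x ≤ y → y ≤ x → x ≡ y
    ≤→⇒     : ∀ {x y} → x ≤ y → x ⇒ y ≡ one
    ⇒→≤     : ∀ {x y} → x ⇒ y ≡ one → x ≤ y
    ≤→⇝     : ∀ {x y} → x ≤ y → x ⇝ y ≡ one
    ⇝→≤     : ∀ {x y} → x ⇝ y ≡ one → x ≤ y
    zero≤   : ∀ x → zero ≤ x

module _ (A : BoundedPseudoBCK) where
  open BoundedPseudoBCK A

  IsFilter : (Carrier → Set) → Set
  IsFilter F = F one × (∀ a b → F a → F (a ⇒ b) → F b)

  IsProper : (Carrier → Set) → Set
  IsProper F = ∃ λ a → ¬ F a

  IsNormal : (Carrier → Set) → Set
  IsNormal F = ∀ a b → (F (a ⇒ b) → F (a ⇝ b)) × (F (a ⇝ b) → F (a ⇒ b))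

  IsMaximalFilter : (Carrier → Set) → Set₁
  IsMaximalFilter F =
    IsFilter F × IsProper F ×
    (∀ (G : Carrier → Set) → IsFilter G → IsProper G →
       (∀ a → F a → G a) → ∀ a → G a → F a)

module _ (R : RealField) (A : BoundedPseudoBCK) where
  open RealField R
  open BoundedPseudoBCK A renaming (_≤_ to _≼_)

  IsBosbachState : (Carrier → ℝ) → Set
  IsBosbachState s =
    (∀ x → (0ℝ ≤ s x) × (s x ≤ 1ℝ)) ×
    (∀ x y → s x + s (x ⇒ y) ≡ s y + s (y ⇒ x)) ×
    (∀ x y → s x + s (x ⇝ y) ≡ s y + s (y ⇝ x)) ×
    s zero ≡ 0ℝ × s one ≡ 1ℝ

  IsStateMorphism : (Carrier → ℝ) → Set
  IsStateMorphism m =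
    (∀ x → (0ℝ ≤ m x) × (m x ≤ 1ℝ)) ×
    m zero ≡ 0ℝ ×
    (∀ x y → m (x ⇒ y) ≡ min (1ℝ - m x + m y) 1ℝ) ×
    (∀ x y → m (x ⇝ y) ≡ min (1ℝ - m x + m y) 1ℝ)

  Ker : (Carrier → ℝ) → Carrier → Set
  Ker s a = s a ≡ 1ℝ

module Submission where

-- (a) ⇒ (b).  The state-morphism formula makes Ker(s) normal.  If a proper
-- filter G ⊇ Ker(s) contains a, then the powers a ⇒ (a ⇒ ... 0) stay outside
-- G, hence outside the kernel, so their states are the multiples n(1 - s a);
-- these are bounded by 1, and the archimedean property of the complete
-- ordered field gives s a = 1.
--
-- (b) ⇒ (a).  Write a ≼ b for a ⇒ b ∈ Ker(s).  From the Bosbach identities,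
-- normality makes ≼ a preorder compatible with both arrows, satisfying
-- quasi-commutativity, double negation and contraposition, and hence the
-- prelinearity inequality (x ⇒ y) ⇒ (y ⇒ x) ≼ y ⇒ x (and its mirror image,
-- obtained in the algebra with the arrows swapped).  Maximality applied to
-- the filter generated by Ker(s) and x ⇝ y then shows that x ⇒ y or y ⇒ x
-- lies in the kernel, and either case gives the state-morphism formula.

open import Defs
open import Data.Product using (_×_)
open import Function.Bundles using (_⇔_)

open import Data.Nat.Base using (ℕ) renaming (zero to zeroℕ; suc to sucℕ; _+_ to _+ℕ_)
open import Function.Bundles using (mk⇔)
open import Data.Product using (∃; _,_; proj₁; proj₂; swap)
open import Data.Sum using (_⊎_; inj₁; inj₂)
open import Relation.Nullary using (¬_; yes; no)
open import Data.Empty using (⊥-elim)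
open import Relation.Binary.PropositionalEquality
  using (_≡_; refl; sym; trans; cong; subst; isEquivalence; module ≡-Reasoning)
open import Relation.Binary.Structures using (IsDecTotalOrder; IsPreorder)
open import Relation.Binary.Bundles using (Poset)
open import Algebra.Bundles using (CommutativeRing)
import Algebra.Properties.CommutativeSemigroup as CommSemigroupProperties
import Relation.Binary.Reasoning.PartialOrder as PosetReasoning
import Relation.Binary.Reasoning.Base.Double as PreorderReasoning

module OrderedField (R : RealField) where
  open RealField R
  open IsDecTotalOrder isDecTotalOrder public
    using (_≟_) renaming (refl to ≤-refl; antisym to ≤-antisym)

  commutativeRing : CommutativeRing _ _
  commutativeRing = record { isCommutativeRing = isCommutativeRing }
  open CommutativeRing commutativeRing public
    using (+-comm; +-assoc; +-identityˡ; +-identityʳ; -‿inverseˡ; -‿inverseʳ)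
  open CommSemigroupProperties (CommutativeRing.+-commutativeSemigroup commutativeRing) public
    using (x∙yz≈yx∙z; xy∙z≈y∙xz; x∙yz≈z∙xy; x∙yz≈zx∙y)

  poset : Poset _ _ _
  poset = record { isPartialOrder = IsDecTotalOrder.isPartialOrder isDecTotalOrder }
  module ≤-Reasoning = PosetReasoning poset

  +-monoˡ-≤ : ∀ z {x y} → x ≤ y → z + x ≤ z + y
  +-monoˡ-≤ z {x} {y} x≤y = begin
    z + x  ≡⟨ +-comm z x ⟩
    x + z  ≤⟨ +-mono-≤ z x≤y ⟩
    y + z  ≡⟨ +-comm y z ⟩
    z + y  ∎
    where open ≤-Reasoning

  plus-minus : ∀ a c → (a + c) - c ≡ a
  plus-minus a c = begin
    (a + c) + - c  ≡⟨ +-assoc a c (- c) ⟩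
    a + (c + - c)  ≡⟨ cong (a +_) (-‿inverseʳ c) ⟩
    a + 0ℝ         ≡⟨ +-identityʳ a ⟩
    a              ∎
    where open ≡-Reasoning

  minus-plus : ∀ a c → (a - c) + c ≡ a
  minus-plus a c = begin
    (a + - c) + c  ≡⟨ +-assoc a (- c) c ⟩
    a + (- c + c)  ≡⟨ cong (a +_) (-‿inverseˡ c) ⟩
    a + 0ℝ         ≡⟨ +-identityʳ a ⟩
    a              ∎
    where open ≡-Reasoning

  +-cancelʳ : ∀ {a b} c → a + c ≡ b + c → a ≡ b
  +-cancelʳ {a} {b} c e = begin
    a            ≡⟨ plus-minus a c ⟨
    (a + c) - c  ≡⟨ cong (_- c) e ⟩
    (b + c) - c  ≡⟨ plus-minus b c ⟩
    b            ∎
    where open ≡-Reasoning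

  +-cancelʳ-≤ : ∀ {a b} c → a + c ≤ b + c → a ≤ b
  +-cancelʳ-≤ {a} {b} c a+c≤b+c = begin
    a            ≡⟨ plus-minus a c ⟨
    (a + c) - c  ≤⟨ +-mono-≤ (- c) a+c≤b+c ⟩
    (b + c) - c  ≡⟨ plus-minus b c ⟩
    b            ∎
    where open ≤-Reasoning

  difference-nonpositive : ∀ {x y} → x - y ≤ 0ℝ → x ≤ y
  difference-nonpositive {x} {y} x-y≤0 = begin
    x            ≡⟨ minus-plus x y ⟨
    (x - y) + y  ≤⟨ +-mono-≤ y x-y≤0 ⟩
    0ℝ + y       ≡⟨ +-identityˡ y ⟩
    y            ∎
    where open ≤-Reasoning

  solve-for-summand : ∀ {x y t} → x + t ≡ y + 1ℝ → t ≡ 1ℝ - x + y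
  solve-for-summand {x} {y} {t} e = begin
    t                ≡⟨ +-identityˡ t ⟨
    0ℝ + t           ≡⟨ cong (_+ t) (-‿inverseˡ x) ⟨
    (- x + x) + t    ≡⟨ +-assoc (- x) x t ⟩
    - x + (x + t)    ≡⟨ cong (- x +_) e ⟩
    - x + (y + 1ℝ)   ≡⟨ x∙yz≈zx∙y (- x) y 1ℝ ⟩
    1ℝ - x + y       ∎
    where open ≡-Reasoning

  one≤1-x+y : ∀ {x y} → x ≤ y → 1ℝ ≤ 1ℝ - x + y
  one≤1-x+y {x} {y} x≤y = begin
    1ℝ            ≡⟨ minus-plus 1ℝ x ⟨
    (1ℝ - x) + x  ≤⟨ +-monoˡ-≤ (1ℝ - x) x≤y ⟩
    1ℝ - x + y    ∎
    where open ≤-Reasoning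

  balance-≤ : ∀ {a b t} → a + 1ℝ ≡ b + t → t ≤ 1ℝ → a ≤ b
  balance-≤ {a} {b} {t} e t≤1 = +-cancelʳ-≤ 1ℝ (begin
    a + 1ℝ  ≡⟨ e ⟩
    b + t   ≤⟨ +-monoˡ-≤ b t≤1 ⟩
    b + 1ℝ  ∎)
    where open ≤-Reasoning

  balance-top : ∀ {a b t} → a + 1ℝ ≡ b + t → b ≤ a → t ≤ 1ℝ → t ≡ 1ℝ
  balance-top {a} {b} {t} e b≤a t≤1 = ≤-antisym t≤1 (+-cancelʳ-≤ a (begin
    1ℝ + a  ≡⟨ +-comm 1ℝ a ⟩
    a + 1ℝ  ≡⟨ e ⟩
    b + t   ≤⟨ +-mono-≤ t b≤a ⟩
    a + t   ≡⟨ +-comm a t ⟩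
    t + a   ∎))
    where open ≤-Reasoning

  balance-transfer : ∀ {a b p q r z} →
    a + 1ℝ ≡ z + p → b + 1ℝ ≡ q + z → a + q ≡ b + r → r ≡ p
  balance-transfer {a} {b} {p} {q} {r} {z} e₁ e₂ e₃ = +-cancelʳ (b + 1ℝ) (begin
    r + (b + 1ℝ)  ≡⟨ x∙yz≈yx∙z r b 1ℝ ⟩
    (b + r) + 1ℝ  ≡⟨ cong (_+ 1ℝ) e₃ ⟨
    (a + q) + 1ℝ  ≡⟨ xy∙z≈y∙xz a q 1ℝ ⟩
    q + (a + 1ℝ)  ≡⟨ cong (q +_) e₁ ⟩
    q + (z + p)   ≡⟨ x∙yz≈z∙xy q z p ⟩
    p + (q + z)   ≡⟨ cong (p +_) e₂ ⟨
    p + (b + 1ℝ)  ∎)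
    where open ≡-Reasoning

  min-left : ∀ {p q} → p ≤ q → min p q ≡ p
  min-left {p} {q} p≤q with p ≤? q
  ... | yes _ = refl
  ... | no p≰q = ⊥-elim (p≰q p≤q)

  min-right : ∀ {p q} → q ≤ p → min p q ≡ q
  min-right {p} {q} q≤p with p ≤? q
  ... | yes p≤q = ≤-antisym p≤q q≤p
  ... | no _ = refl

  min-not-right : ∀ {p q} → ¬ min p q ≡ q → min p q ≡ p
  min-not-right {p} {q} ≢q with p ≤? q
  ... | yes _ = refl
  ... | no _ = ⊥-elim (≢q refl)

  infixr 7 _·_
  _·_ : ℕ → ℝ → ℝ
  zeroℕ  · x = 0ℝ
  sucℕ n · x = x + n · x

  -- A complete ordered field is archimedean: if all multiples of ε are
  -- bounded above then ε ≤ 0.  The supremum σ of the multiples satisfies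
  -- σ ≤ σ - ε, since σ - ε bounds them all.
  archimedean : ∀ ε b → (∀ n → n · ε ≤ b) → ε ≤ 0ℝ
  archimedean ε b bounded = +-cancelʳ-≤ σ (begin
    ε + σ        ≡⟨ +-comm ε σ ⟩
    σ + ε        ≤⟨ +-mono-≤ ε (least (σ - ε) shifted-bound) ⟩
    (σ - ε) + ε  ≡⟨ minus-plus σ ε ⟩
    σ            ≡⟨ +-identityˡ σ ⟨
    0ℝ + σ       ∎)
    where
    open ≤-Reasoning
    Multiple : ℝ → Set
    Multiple r = ∃ λ n → r ≡ n · ε
    supremum : ∃ λ σ → (∀ r → Multiple r → r ≤ σ) ×
                       (∀ c → (∀ r → Multiple r → r ≤ c) → σ ≤ c)
    supremum = complete Multiple (0ℝ , zeroℕ , refl) (b , λ { _ (n , refl) → bounded n })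
    σ : ℝ
    σ = proj₁ supremum
    upper : ∀ r → Multiple r → r ≤ σ
    upper = proj₁ (proj₂ supremum)
    least : ∀ c → (∀ r → Multiple r → r ≤ c) → σ ≤ c
    least = proj₂ (proj₂ supremum)
    shifted-bound : ∀ r → Multiple r → r ≤ σ - ε
    shifted-bound _ (n , refl) = begin
      n · ε                ≡⟨ plus-minus (n · ε) ε ⟨
      (n · ε + ε) - ε      ≡⟨ cong (_- ε) (+-comm (n · ε) ε) ⟩
      sucℕ n · ε - ε       ≤⟨ +-mono-≤ (- ε) (upper _ (sucℕ n , refl)) ⟩
      σ - ε                ∎

module PseudoBCKFacts (A : BoundedPseudoBCK) where
  open BoundedPseudoBCK A

  one-maximum : ∀ {a} → one ≤ a → a ≡ one
  one-maximum = antisym (≤one _)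

  ⇒-antitone : ∀ {p q} r → p ≤ q → q ⇒ r ≤ p ⇒ r
  ⇒-antitone {p} {q} r p≤q =
    ⇝→≤ (one-maximum (subst (_≤ (q ⇒ r) ⇝ (p ⇒ r)) (≤→⇒ p≤q) (ax1 p q r)))

  ⇝-antitone : ∀ {p q} r → p ≤ q → q ⇝ r ≤ p ⇝ r
  ⇝-antitone {p} {q} r p≤q =
    ⇒→≤ (one-maximum (subst (_≤ (q ⇝ r) ⇒ (p ⇝ r)) (≤→⇝ p≤q) (ax1' p q r)))

  ≤-trans : ∀ {x y z} → x ≤ y → y ≤ z → x ≤ z
  ≤-trans {x} {y} {z} x≤y y≤z =
    ⇒→≤ (one-maximum (subst (_≤ x ⇒ z) (≤→⇒ y≤z) (⇒-antitone z x≤y)))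

  ⇒-to-⇝ : ∀ {a b c} → a ≤ b ⇒ c → b ≤ a ⇝ c
  ⇒-to-⇝ {a} {b} {c} a≤b⇒c = ≤-trans (ax2 b c) (⇝-antitone c a≤b⇒c)

  ⇝-to-⇒ : ∀ {a b c} → a ≤ b ⇝ c → b ≤ a ⇒ c
  ⇝-to-⇒ {a} {b} {c} a≤b⇝c = ≤-trans (ax2' b c) (⇒-antitone c a≤b⇝c)

  ≤-⇒-weaken : ∀ x y → x ≤ y ⇒ x
  ≤-⇒-weaken x y = ⇝-to-⇒ (subst (y ≤_) (sym (≤→⇝ (refl≤ x))) (≤one y))

  ≤-⇝-weaken : ∀ x y → x ≤ y ⇝ x
  ≤-⇝-weaken x y = ⇒-to-⇝ (subst (y ≤_) (sym (≤→⇒ (refl≤ x))) (≤one y))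

  one-⇒ : ∀ x → one ⇒ x ≡ x
  one-⇒ x = antisym (⇝→≤ (one-maximum (ax2 one x))) (≤-⇒-weaken x one)

  one-⇝ : ∀ x → one ⇝ x ≡ x
  one-⇝ x = antisym (⇒→≤ (one-maximum (ax2' one x))) (≤-⇝-weaken x one)

  ⇒-⇝-exchange : ∀ a b c → a ⇒ (b ⇝ c) ≡ b ⇝ (a ⇒ c)
  ⇒-⇝-exchange a b c =
    antisym (≤-trans (ax1 a (b ⇝ c) c) (⇝-antitone (a ⇒ c) (ax2' b c)))
            (≤-trans (ax1' b (a ⇒ c) c) (⇒-antitone (b ⇝ c) (ax2 a c)))

  triple-⇒ : ∀ a b → ((a ⇒ b) ⇝ b) ⇒ b ≡ a ⇒ b
  triple-⇒ a b = antisym (⇒-antitone b (ax2 a b)) (ax2' (a ⇒ b) b)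

-- The mirror image of a pseudo-BCK algebra, with the two arrows swapped.
-- Every statement proved for all algebras thereby yields its mirror image.
dual : BoundedPseudoBCK → BoundedPseudoBCK
dual A = record
  { Carrier = Carrier ; _≤_ = _≤_ ; _⇒_ = _⇝_ ; _⇝_ = _⇒_ ; one = one ; zero = zero
  ; ax1 = ax1' ; ax1' = ax1 ; ax2 = ax2' ; ax2' = ax2 ; refl≤ = refl≤ ; ≤one = ≤one
  ; antisym = antisym ; ≤→⇒ = ≤→⇝ ; ⇒→≤ = ⇝→≤ ; ≤→⇝ = ≤→⇒ ; ⇝→≤ = ⇒→≤ ; zero≤ = zero≤ }
  where open BoundedPseudoBCK A

module BosbachState (R : RealField) (A : BoundedPseudoBCK)
  (s : BoundedPseudoBCK.Carrier A → RealField.ℝ R) (bos : IsBosbachState R A s) where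
  open RealField R
  open OrderedField R
  open BoundedPseudoBCK A renaming (_≤_ to _⊑_)
  open PseudoBCKFacts A

  s≤1 : ∀ x → s x ≤ 1ℝ
  s≤1 x = proj₂ (proj₁ bos x)

  bosbach⇒ : ∀ x y → s x + s (x ⇒ y) ≡ s y + s (y ⇒ x)
  bosbach⇒ = proj₁ (proj₂ bos)

  bosbach⇝ : ∀ x y → s x + s (x ⇝ y) ≡ s y + s (y ⇝ x)
  bosbach⇝ = proj₁ (proj₂ (proj₂ bos))

  s-zero : s zero ≡ 0ℝ
  s-zero = proj₁ (proj₂ (proj₂ (proj₂ bos)))

  s-one : s one ≡ 1ℝ
  s-one = proj₂ (proj₂ (proj₂ (proj₂ bos)))

  K : Carrier → Set
  K = Ker R A s

  ker-⇒ : ∀ {a b} → a ⊑ b → K (a ⇒ b)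
  ker-⇒ a⊑b = trans (cong s (≤→⇒ a⊑b)) s-one

  ker-⇝ : ∀ {a b} → a ⊑ b → K (a ⇝ b)
  ker-⇝ a⊑b = trans (cong s (≤→⇝ a⊑b)) s-one

  bosbach-ker⇒ : ∀ {a b} → K (a ⇒ b) → s a + 1ℝ ≡ s b + s (b ⇒ a)
  bosbach-ker⇒ {a} {b} k = trans (cong (s a +_) (sym k)) (bosbach⇒ a b)

  bosbach-ker⇝ : ∀ {a b} → K (a ⇝ b) → s a + 1ℝ ≡ s b + s (b ⇝ a)
  bosbach-ker⇝ {a} {b} k = trans (cong (s a +_) (sym k)) (bosbach⇝ a b)

  s-monotone : ∀ {a b} → a ⊑ b → s a ≤ s b
  s-monotone a⊑b = balance-≤ (bosbach-ker⇒ (ker-⇒ a⊑b)) (s≤1 _)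

  ker-upward : ∀ {a b} → a ⊑ b → K a → K b
  ker-upward {a} {b} a⊑b ka = ≤-antisym (s≤1 b) (subst (_≤ s b) ka (s-monotone a⊑b))

  ker-mp⇒ : ∀ {a b} → K a → K (a ⇒ b) → K b
  ker-mp⇒ {a} {b} ka kab = ≤-antisym (s≤1 b)
    (balance-≤ (trans (cong (_+ 1ℝ) (sym ka)) (bosbach-ker⇒ kab)) (s≤1 (b ⇒ a)))

  ker-mp⇝ : ∀ {a b} → K a → K (a ⇝ b) → K b
  ker-mp⇝ {a} {b} ka kab = ≤-antisym (s≤1 b)
    (balance-≤ (trans (cong (_+ 1ℝ) (sym ka)) (bosbach-ker⇝ kab)) (s≤1 (b ⇝ a)))

  ker-filter : IsFilter A K
  ker-filter = s-one , λ _ _ → ker-mp⇒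

  infix 4 _≼_
  _≼_ : Carrier → Carrier → Set
  a ≼ b = K (a ⇒ b)

  ⊑→≼ : ∀ {a b} → a ⊑ b → a ≼ b
  ⊑→≼ = ker-⇒

  ≼-trans : ∀ {a b c} → a ≼ b → b ≼ c → a ≼ c
  ≼-trans {a} {b} {c} a≼b b≼c = ker-mp⇝ b≼c (ker-upward (ax1 a b c) a≼b)

  ≼-isPreorder : IsPreorder _≡_ _≼_
  ≼-isPreorder = record
    { isEquivalence = isEquivalence
    ; reflexive = λ { {a} refl → ⊑→≼ (refl≤ a) }
    ; trans = ≼-trans
    }

  module ≼-Reasoning = PreorderReasoning ≼-isPreorder

  ≼-reverse : ∀ {a b} → a ≼ b → s b ≤ s a → b ≼ a
  ≼-reverse a≼b sb≤sa = balance-top (bosbach-ker⇒ a≼b) sb≤sa (s≤1 _)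

  -- Comparing the Bosbach identities of (a, z), (b, a ⇒ b) and (a, b)
  -- for z = (a ⇒ b) ⇝ b shows that z ⇒ a and b ⇒ a have the same state.
  s-triple : ∀ a b → s (b ⇒ a) ≡ s (((a ⇒ b) ⇝ b) ⇒ a)
  s-triple a b = balance-transfer
    (bosbach-ker⇒ (ker-⇒ (ax2 a b)))
    (bosbach-ker⇝ (ker-⇝ (≤-⇒-weaken b a)))
    (bosbach⇒ a b)

dual-state : ∀ R A s → IsBosbachState R A s → IsBosbachState R (dual A) s
dual-state _ _ _ (bounded , bosbach⇒ , bosbach⇝ , s-zero , s-one) =
  bounded , bosbach⇝ , bosbach⇒ , s-zero , s-one

dual-normal : ∀ R A s → IsNormal A (Ker R A s) → IsNormal (dual A) (Ker R (dual A) s)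
dual-normal _ _ _ normal a b = swap (normal a b)

-- When Ker(s) is normal, ≼ may be read with either arrow and is compatible
-- with both arrows; modulo the kernel A then behaves like a commutative algebra.
module NormalKernel (R : RealField) (A : BoundedPseudoBCK)
  (s : BoundedPseudoBCK.Carrier A → RealField.ℝ R) (bos : IsBosbachState R A s)
  (normal : IsNormal A (Ker R A s)) where
  open RealField R
  open OrderedField R
  open BoundedPseudoBCK A renaming (_≤_ to _⊑_)
  open PseudoBCKFacts A
  open BosbachState R A s bos public

  ≼→ker⇝ : ∀ {a b} → a ≼ b → K (a ⇝ b)
  ≼→ker⇝ {a} {b} = proj₁ (normal a b)

  ker⇝→≼ : ∀ {a b} → K (a ⇝ b) → a ≼ b
  ker⇝→≼ {a} {b} = proj₂ (normal a b)

  ≼-antitone : ∀ {a b} c → a ≼ b → b ⇒ c ≼ a ⇒ c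
  ≼-antitone {a} {b} c a≼b = ker⇝→≼ (ker-upward (ax1 a b c) a≼b)

  ≼-monotone : ∀ {a b} c → a ≼ b → c ⇒ a ≼ c ⇒ b
  ≼-monotone {a} {b} c a≼b = ker-upward (⇝-to-⇒ (ax1 c a b)) a≼b

  ≼-monotone⇝ : ∀ {a b} c → a ≼ b → c ⇝ a ≼ c ⇝ b
  ≼-monotone⇝ {a} {b} c a≼b = ker⇝→≼ (ker-upward (⇒-to-⇝ (ax1' c a b)) (≼→ker⇝ a≼b))

  -- Quasi-commutativity: (a ⇒ b) ⇝ b ≼ (b ⇒ a) ⇝ a.  With z = (a ⇒ b) ⇝ b,
  -- z ⇒ a ⊑ b ⇒ a have equal states, so b ⇒ a ≼ z ⇒ a; exchange the arrows.
  quasi-commutative : ∀ a b → (a ⇒ b) ⇝ b ≼ (b ⇒ a) ⇝ a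
  quasi-commutative a b =
    subst K (sym (⇒-⇝-exchange z (b ⇒ a) a)) (≼→ker⇝ b⇒a≼z⇒a)
    where
    z : Carrier
    z = (a ⇒ b) ⇝ b
    b⇒a≼z⇒a : b ⇒ a ≼ z ⇒ a
    b⇒a≼z⇒a = ≼-reverse (⊑→≼ (⇒-antitone a (≤-⇝-weaken b (a ⇒ b))))
                        (subst (_≤ s (z ⇒ a)) (sym (s-triple a b)) ≤-refl)

  neg : Carrier → Carrier
  neg x = x ⇒ zero

  -- Double negation elimination modulo the kernel: quasi-commutativity with b = 0.
  double-negation : ∀ a → neg a ⇝ zero ≼ a
  double-negation a =
    subst (neg a ⇝ zero ≼_) (trans (cong (_⇝ a) (≤→⇒ (zero≤ a))) (one-⇝ a))
          (quasi-commutative a zero)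

module Prelinearity (R : RealField) (A : BoundedPseudoBCK)
  (s : BoundedPseudoBCK.Carrier A → RealField.ℝ R) (bos : IsBosbachState R A s)
  (normal : IsNormal A (Ker R A s)) where
  open BoundedPseudoBCK A renaming (_≤_ to _⊑_)
  open PseudoBCKFacts A
  open NormalKernel R A s bos normal public
  private
    module Mirror = NormalKernel R (dual A) s (dual-state R A s bos) (dual-normal R A s normal)

  quasi-commutative⇝ : ∀ a b → (a ⇝ b) ⇒ b ≼ (b ⇝ a) ⇒ a
  quasi-commutative⇝ a b = ker⇝→≼ (Mirror.quasi-commutative a b)

  contraposition : ∀ a b → neg b ⇝ neg a ≼ a ⇒ b
  contraposition a b = begin
    neg b ⇝ neg a                    ≲⟨ ⊑→≼ (ax1' (neg b) (neg a) zero) ⟩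
    (neg a ⇝ zero) ⇒ (neg b ⇝ zero)  ≲⟨ ≼-antitone (neg b ⇝ zero) (⊑→≼ (ax2 a zero)) ⟩
    a ⇒ (neg b ⇝ zero)               ≲⟨ ≼-monotone a (double-negation b) ⟩
    a ⇒ b                            ∎
    where open ≼-Reasoning

  neg-antitone : ∀ {a b} → a ⊑ b → neg b ⇝ neg a ≡ one
  neg-antitone {a} {b} a⊑b =
    one-maximum (subst (_⊑ neg b ⇝ neg a) (≤→⇒ a⊑b) (ax1 a b zero))

  -- With u = x ⇒ y and j = u ⇝ y (so u = j ⇒ y), pass through negations:
  -- u ⇒ v ≼ (j ⇒ y) ⇒ (¬x ⇝ ¬j) = ¬x ⇝ ((j ⇒ y) ⇒ ¬j) ≼ ¬x ⇝ ¬y ≼ v.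
  prelinearity : ∀ x y → (x ⇒ y) ⇒ (y ⇒ x) ≼ y ⇒ x
  prelinearity x y = begin
    u ⇒ (y ⇒ x)                   ≲⟨ ≼-monotone u y⇒x≼j⇒x ⟩
    u ⇒ (j ⇒ x)                   ≡⟨ cong (_⇒ (j ⇒ x)) (sym (triple-⇒ x y)) ⟩
    (j ⇒ y) ⇒ (j ⇒ x)             ≲⟨ ≼-monotone (j ⇒ y) (⊑→≼ (ax1 j x zero)) ⟩
    (j ⇒ y) ⇒ (neg x ⇝ neg j)     ≡⟨ ⇒-⇝-exchange (j ⇒ y) (neg x) (neg j) ⟩
    neg x ⇝ ((j ⇒ y) ⇒ neg j)     ≲⟨ ≼-monotone⇝ (neg x) j⇒y⇒¬j≼¬y ⟩
    neg x ⇝ neg y                 ≲⟨ contraposition y x ⟩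
    y ⇒ x                         ∎
    where
    open ≼-Reasoning
    u j : Carrier
    u = x ⇒ y
    j = u ⇝ y
    y⇒x≼j⇒x : y ⇒ x ≼ j ⇒ x
    y⇒x≼j⇒x = begin
      y ⇒ x                  ≡⟨ triple-⇒ y x ⟨
      ((y ⇒ x) ⇝ x) ⇒ x      ≲⟨ ≼-antitone x (quasi-commutative x y) ⟩
      j ⇒ x                  ∎
    j⇒y⇒¬j≼¬y : (j ⇒ y) ⇒ neg j ≼ neg y
    j⇒y⇒¬j≼¬y = begin
      (j ⇒ y) ⇒ neg j              ≲⟨ ≼-antitone (neg j) (contraposition j y) ⟩
      (neg y ⇝ neg j) ⇒ neg j      ≲⟨ quasi-commutative⇝ (neg y) (neg j) ⟩
      (neg j ⇝ neg y) ⇒ neg y      ≡⟨ cong (_⇒ neg y) (neg-antitone (≤-⇝-weaken y u)) ⟩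
      one ⇒ neg y                  ≡⟨ one-⇒ (neg y) ⟩
      neg y                        ∎

-- (b) ⇒ (a): if Ker(s) is normal and maximal, any two elements are
-- comparable modulo the kernel, which forces the state-morphism formula.
module MaximalKernel (R : RealField) (A : BoundedPseudoBCK)
  (s : BoundedPseudoBCK.Carrier A → RealField.ℝ R) (bos : IsBosbachState R A s)
  (normal : IsNormal A (Ker R A s))
  (maximal : ∀ (G : BoundedPseudoBCK.Carrier A → Set) → IsFilter A G → IsProper A G →
               (∀ a → Ker R A s a → G a) → ∀ a → G a → Ker R A s a) where
  open RealField R
  open OrderedField R
  open BoundedPseudoBCK A renaming (_≤_ to _⊑_)
  open PseudoBCKFacts A
  open Prelinearity R A s bos normal

  prelinearity⇝ : ∀ x y → (x ⇝ y) ⇝ (y ⇝ x) ≼ y ⇝ x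
  prelinearity⇝ x y = ker⇝→≼ (Prelinearity.prelinearity R (dual A) s
                                 (dual-state R A s bos) (dual-normal R A s normal) x y)

  _⇝[_]_ : Carrier → ℕ → Carrier → Carrier
  u ⇝[ zeroℕ ] b = b
  u ⇝[ sucℕ n ] b = u ⇝ (u ⇝[ n ] b)

  iterate-bound : ∀ {u v} → u ⇝ v ≼ v → ∀ n → u ⇝[ n ] v ≼ v
  iterate-bound {v = v} _ zeroℕ = ⊑→≼ (refl≤ v)
  iterate-bound {u} u⇝v≼v (sucℕ n) = ≼-trans (≼-monotone⇝ u (iterate-bound u⇝v≼v n)) u⇝v≼v

  iterate-exchange : ∀ u a b m → u ⇝[ m ] (a ⇒ b) ≡ a ⇒ (u ⇝[ m ] b)
  iterate-exchange u a b zeroℕ = refl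
  iterate-exchange u a b (sucℕ m) =
    trans (cong (u ⇝_) (iterate-exchange u a b m)) (sym (⇒-⇝-exchange a u (u ⇝[ m ] b)))

  iterate-monotone : ∀ u {a c} → a ≼ c → ∀ n → u ⇝[ n ] a ≼ u ⇝[ n ] c
  iterate-monotone u a≼c zeroℕ = a≼c
  iterate-monotone u a≼c (sucℕ n) = ≼-monotone⇝ u (iterate-monotone u a≼c n)

  iterate-add : ∀ u b n m → u ⇝[ n ] (u ⇝[ m ] b) ≡ u ⇝[ n +ℕ m ] b
  iterate-add u b zeroℕ m = refl
  iterate-add u b (sucℕ n) m = cong (u ⇝_) (iterate-add u b n m)

  -- The filter generated by Ker(s) and u.
  Generated : Carrier → Carrier → Set
  Generated u b = ∃ λ n → K (u ⇝[ n ] b)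

  generated-filter : ∀ u → IsFilter A (Generated u)
  generated-filter u = (zeroℕ , s-one) , modus-ponens
    where
    modus-ponens : ∀ a b → Generated u a → Generated u (a ⇒ b) → Generated u b
    modus-ponens a b (n , ka) (m , kab) = n +ℕ m , subst K (iterate-add u b n m)
      (ker-mp⇒ ka (iterate-monotone u (subst K (iterate-exchange u a b m) kab) n))

  -- If y ⇒ x ∉ Ker(s), then the filter generated by u = x ⇝ y misses
  -- y ⇝ x (by prelinearity), so by maximality u lies in the kernel.
  comparable : ∀ x y → ¬ K (y ⇒ x) → K (x ⇒ y)
  comparable x y y⇒x∉K = ker⇝→≼ (maximal (Generated u) (generated-filter u)
      (v , v∉Generated) (λ _ k → zeroℕ , k) u (1 , ker-⇝ (refl≤ u)))
    where
    u v : Carrier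
    u = x ⇝ y
    v = y ⇝ x
    v∉Generated : ¬ Generated u v
    v∉Generated (n , k) = y⇒x∉K (ker⇝→≼ (ker-mp⇒ k (iterate-bound (prelinearity⇝ x y) n)))

  -- Any two elements are comparable modulo the kernel (s takes decidable
  -- values, so the case split is constructive).
  dichotomy : ∀ x y → K (x ⇒ y) ⊎ K (y ⇒ x)
  dichotomy x y with s (y ⇒ x) ≟ 1ℝ
  ... | yes k = inj₂ k
  ... | no y⇒x∉K = inj₁ (comparable x y y⇒x∉K)

  state-of-arrow : (_→'_ : Carrier → Carrier → Carrier) →
    (∀ x y → s x + s (x →' y) ≡ s y + s (y →' x)) →
    ∀ x y → K (x →' y) ⊎ K (y →' x) → s (x →' y) ≡ min (1ℝ - s x + s y) 1ℝ
  state-of-arrow _→'_ bosbach x y (inj₁ k) = trans k (sym (min-right (one≤1-x+y sx≤sy)))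
    where
    sx≤sy : s x ≤ s y
    sx≤sy = balance-≤ (trans (cong (s x +_) (sym k)) (bosbach x y)) (s≤1 (y →' x))
  state-of-arrow _→'_ bosbach x y (inj₂ k) =
    trans value (sym (min-left (subst (_≤ 1ℝ) value (s≤1 (x →' y)))))
    where
    value : s (x →' y) ≡ 1ℝ - s x + s y
    value = solve-for-summand (trans (bosbach x y) (cong (s y +_) k))

  state-morphism : IsStateMorphism R A s
  state-morphism = proj₁ bos , s-zero
    , (λ x y → state-of-arrow _⇒_ bosbach⇒ x y (dichotomy x y))
    , (λ x y → state-of-arrow _⇝_ bosbach⇝ x y (dichotomy⇝ x y))
    where
    dichotomy⇝ : ∀ x y → K (x ⇝ y) ⊎ K (y ⇝ x)
    dichotomy⇝ x y with dichotomy x y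
    ... | inj₁ k = inj₁ (≼→ker⇝ k)
    ... | inj₂ k = inj₂ (≼→ker⇝ k)

module StateMorphismKernel (R : RealField) (A : BoundedPseudoBCK)
  (s : BoundedPseudoBCK.Carrier A → RealField.ℝ R) (bos : IsBosbachState R A s)
  (morphism : IsStateMorphism R A s) where
  open RealField R
  open OrderedField R
  open BoundedPseudoBCK A renaming (_≤_ to _⊑_)
  open BosbachState R A s bos public

  morphism⇒ : ∀ x y → s (x ⇒ y) ≡ min (1ℝ - s x + s y) 1ℝ
  morphism⇒ = proj₁ (proj₂ (proj₂ morphism))

  morphism⇝ : ∀ x y → s (x ⇝ y) ≡ min (1ℝ - s x + s y) 1ℝ
  morphism⇝ = proj₂ (proj₂ (proj₂ morphism))

  ker-normal : IsNormal A K
  ker-normal a b = (λ k → trans (morphism⇝ a b) (trans (sym (morphism⇒ a b)) k))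
                 , (λ k → trans (morphism⇒ a b) (trans (sym (morphism⇝ a b)) k))

  ker-proper : IsProper A K
  ker-proper = zero , λ k → 0≢1 (trans (sym s-zero) k)

  powers : Carrier → ℕ → Carrier
  powers a zeroℕ = zero
  powers a (sucℕ n) = a ⇒ powers a n

  powers-outside : ∀ {G a} → IsFilter A G → IsProper A G → G a → ∀ n → ¬ G (powers a n)
  powers-outside {G} (G-one , G-mp) (b , b∉G) _ zeroℕ G-zero =
    b∉G (G-mp zero b G-zero (subst G (sym (≤→⇒ (zero≤ b))) G-one))
  powers-outside {G} {a} filter proper Ga (sucℕ n) G-power =
    powers-outside filter proper Ga n (proj₂ filter a (powers a n) Ga G-power)

  -- Outside the kernel the state-morphism formula has no truncation, so the
  -- states of the powers grow linearly.
  powers-value : ∀ a → (∀ n → ¬ K (powers a n)) → ∀ n → s (powers a n) ≡ n · (1ℝ - s a)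
  powers-value a outside zeroℕ = s-zero
  powers-value a outside (sucℕ n) = begin
    s (a ⇒ powers a n)                 ≡⟨ morphism⇒ a (powers a n) ⟩
    min (1ℝ - s a + s (powers a n)) 1ℝ ≡⟨ min-not-right untruncated ⟩
    1ℝ - s a + s (powers a n)          ≡⟨ cong (1ℝ - s a +_) (powers-value a outside n) ⟩
    sucℕ n · (1ℝ - s a)                ∎
    where
    open ≡-Reasoning
    untruncated : ¬ min (1ℝ - s a + s (powers a n)) 1ℝ ≡ 1ℝ
    untruncated e = outside (sucℕ n) (trans (morphism⇒ a (powers a n)) e)

  -- A proper filter G ⊇ Ker(s) containing a has all multiples of 1 - s a
  -- bounded by 1, so s a = 1 by the archimedean property.
  ker-maximal : ∀ (G : Carrier → Set) → IsFilter A G → IsProper A G →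
                (∀ a → K a → G a) → ∀ a → G a → K a
  ker-maximal G filter proper ker⊆G a Ga =
    ≤-antisym (s≤1 a) (difference-nonpositive (archimedean (1ℝ - s a) 1ℝ bounded))
    where
    outside : ∀ n → ¬ K (powers a n)
    outside n k = powers-outside filter proper Ga n (ker⊆G _ k)
    bounded : ∀ n → n · (1ℝ - s a) ≤ 1ℝ
    bounded n = subst (_≤ 1ℝ) (powers-value a outside n) (s≤1 (powers a n))

proposition3p22 : (R : RealField) (A : BoundedPseudoBCK)
    (s : BoundedPseudoBCK.Carrier A → RealField.ℝ R) →
    IsBosbachState R A s →
    (IsStateMorphism R A s ⇔ (IsNormal A (Ker R A s) × IsMaximalFilter A (Ker R A s)))
proposition3p22 R A s bos = mk⇔ forward backward
  where
  forward : IsStateMorphism R A s → IsNormal A (Ker R A s) × IsMaximalFilter A (Ker R A s)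
  forward morphism = ker-normal , ker-filter , ker-proper , ker-maximal
    where open StateMorphismKernel R A s bos morphism
  backward : IsNormal A (Ker R A s) × IsMaximalFilter A (Ker R A s) → IsStateMorphism R A s
  backward (normal , _ , _ , maximal) = MaximalKernel.state-morphism R A s bos normal maximal
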